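{- Let $G$ be the simple graph on the $157$ vertices $$a,\ b,\ c_i,\ d_{ij},\ e_{ij},\ p_{ij},\ q_{ij},\ r_{ij},\ s_{ij}\qquad (1\le i,j\le 5)$$ whose edge set consists exactly of the following $311$ edges: $(a,b)$; $(a,c_i)$ and $(b,c_i)$ for $1\le i\le 5$; $(a,d_{ij})$, $(c_i,d_{ij})$, $(b,e_{ij})$, $(c_i,e_{ij})$ for $1\le i,j\le 5$; and $(a,p_{ij})$, $(d_{ij},p_{ij})$, $(c_i,q_{ij})$, $(d_{ij},q_{ij})$, $(b,r_{ij})$, $(e_{ij},r_{ij})$, $(c_i,s_{ij})$, $(e_{ij},s_{ij})$ for $1\le i,j\le 5$. Then $\mathrm{box}(G)=3$.
   Context: Equivalently, $G$ is obtained from the single edge $(a,b)$ by repeated split operations: splitting an edge $(u,v)$ means adding a new vertex $w$ and new edges $(u,w)$, $(v,w)$ (keeping $(u,v)$). Concretely: split $(a,b)$ five times to get $c_1,\dots,c_5$; for each $i$, split $(a,c_i)$ five times to get $d_{i1},\dots,d_{i5}$ and split $(b,c_i)$ five times to get $e_{i1},\dots,e_{i5}$; for each $i,j$, split $(a,d_{ij})$, $(c_i,d_{ij})$, $(b,e_{ij})$, $(c_i,e_{ij})$ to get $p_{ij},q_{ij},r_{ij},s_{ij}$ respectively. In particular $G$ is a series-parallel graph (a $2$-tree). The boxicity $\mathrm{box}(G)$ of a graph $G$ is the minimum $d$ such that each vertex $v$ can be assigned a $d$-dimensional axis-parallel box $R_1\times\cdots\times R_d$ (each $R_i$ a closed real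 interval) so that two distinct vertices are adjacent if and only if their boxes intersect.
   Formalization: Each closed interval $R_i$ of a box has rational endpoints rather than real ones. -}

module Defs where

open import Data.Nat using (ℕ; _<_)
open import Data.Fin using (Fin)
open import Data.Product using (Σ; _×_)
open import Data.Sum using (_⊎_)
open import Data.Rational using (ℚ; _≤_)
open import Relation.Nullary using (¬_)
open import Relation.Binary.PropositionalEquality using (_≡_)
open import Function.Bundles using (_⇔_)

-- A closed (nonempty) interval [lo , hi] with rational endpoints.
-- (For finite graphs, only the relative order of finitely many endpoints
-- matters, so rational endpoints give the same notion as real ones.)
record Interval : Set where
  constructor [_,_]⟨_⟩
  field
    lo  : ℚ
    hi  : ℚ
    lo≤hi : lo ≤ hi
open Interval public

Meets : Interval → Interval → Set
Meets I J = (lo I ≤ hi J) × (lo J ≤ hi I)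

Box : ℕ → Set
Box d = Fin d → Interval

BoxesMeet : ∀ {d} → Box d → Box d → Set
BoxesMeet {d} B C = (k : Fin d) → Meets (B k) (C k)

BoxRep : (V : Set) → (V → V → Set) → ℕ → Set
BoxRep V Adj d =
  Σ (V → Box d) λ f →
    (u v : V) → ¬ (u ≡ v) → (Adj u v ⇔ BoxesMeet (f u) (f v))

HasBoxicity : (V : Set) → (V → V → Set) → ℕ → Set
HasBoxicity V Adj d = BoxRep V Adj d × ((d' : ℕ) → d' < d → ¬ BoxRep V Adj d')

-- The specific 157-vertex graph G (indices i, j range over Fin 5,
-- i.e. 0..4 instead of 1..5).

data Vtx : Set where
  a b : Vtx
  c   : Fin 5 → Vtx
  d e p q r s : Fin 5 → Fin 5 → Vtx

data Edge : Vtx → Vtx → Set where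
  ab   : Edge a b
  ac   : ∀ i → Edge a (c i)
  bc   : ∀ i → Edge b (c i)
  ad   : ∀ i j → Edge a (d i j)
  cd   : ∀ i j → Edge (c i) (d i j)
  be   : ∀ i j → Edge b (e i j)
  ce   : ∀ i j → Edge (c i) (e i j)
  ap   : ∀ i j → Edge a (p i j)
  dp   : ∀ i j → Edge (d i j) (p i j)
  cq   : ∀ i j → Edge (c i) (q i j)
  dq   : ∀ i j → Edge (d i j) (q i j)
  br   : ∀ i j → Edge b (r i j)
  er   : ∀ i j → Edge (e i j) (r i j)
  cs   : ∀ i j → Edge (c i) (s i j)
  es   : ∀ i j → Edge (e i j) (s i j)

Adj : Vtx → Vtx → Set
Adj u v = Edge u v ⊎ Edge v u

{-# OPTIONS --safe #-}
-- Upper bound: explicit integer boxes in dimension 3, verified by evaluation.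
-- Lower bound: suppose G is represented by rectangles I v × J v. If five pairwise non-adjacent
-- vertices are adjacent to both u and w, then one of them has its interval nested in those of u
-- and w in some coordinate: otherwise in each coordinate each of them contains an end of the
-- intersection, so one of the four resulting grid points lies in two rectangles, which then meet.
-- For the c_i this gives some c_i nested in a and b, say in I. Then e_{i0} meets a in I, so it is
-- separated from a in J, say above it (otherwise reflect J). For the d_{ij}, the common
-- neighbours of a and c_i, it gives a d_{ij} nested in a and c_i in I or in J. In J, q_{ij} would
-- meet a in both coordinates. In I, q_{ij} and p_{ij} are separated in J from a and c_i; as d_{ij}
-- lies below b, q_{ij} lies below a, and then p_{ij} fits neither below nor above c_i.
module Submission where

open import Defs
open import Algebra.Properties.Group using (⁻¹-involutive)
open import Data.Empty using (⊥; ⊥-elim)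
open import Data.Fin using (Fin; zero; suc; toℕ; combine)
open import Data.Fin.Patterns using (0F; 1F; 2F; 3F; 4F; 5F; 6F; 7F; 8F)
open import Data.Fin.Properties
  using (all?; pigeonhole; combine-injective; <⇒≢) renaming (_≟_ to _≟ᶠ_)
open import Data.Integer as ℤ using (+_)
import Data.Integer.Properties as ℤ
open import Data.List using (List; []; _∷_)
import Data.List.Membership.DecPropositional as DecMembership
open import Data.List.Membership.Propositional using (_∈_)
open import Data.List.Relation.Unary.Any using (here; there)
open import Data.Nat as ℕ using (ℕ; _+_; _*_)
import Data.Nat.Properties as ℕ
open import Data.Product using (_×_; _,_; proj₁; proj₂; ∃; swap; uncurry)
import Data.Product.Properties as ×
open import Data.Rational using (ℚ; _≤_; _<_; -_; _⊔_; _⊓_; 0ℚ; *≤*)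
open import Data.Rational.Literals using (fromℤ)
open import Data.Rational.Properties
  using (≤-refl; ≤-trans; <⇒≤; ≰⇒>; _≤?_; <-irrefl; neg-antimono-≤; neg-antimono-<; drop-*≤*;
         p≤p⊔q; p≤q⊔p; ⊔-lub; p⊓q≤p; p⊓q≤q; ⊓-glb; +-0-group; module ≤-Reasoning)
open import Data.Sum using (_⊎_; inj₁; inj₂; [_,_]′)
open import Data.Vec using (Vec; []; _∷_; lookup)
open import Function using (_∘_; _∘₂_; id)
open import Function.Bundles using (_⇔_; mk⇔; Equivalence)
open import Function.Definitions using (Injective)
open import Relation.Binary.Definitions using (DecidableEquality; Irreflexive)
open import Relation.Binary.PropositionalEquality
  using (_≡_; _≢_; refl; sym; trans; cong; subst; subst₂)
open import Relation.Nullary using (¬_; Dec; yes; no; ¬?; _×-dec_; _⊎-dec_; _→-dec_)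
open import Relation.Nullary.Decidable using (map′; from-yes)
open import Relation.Unary using (Decidable)

infix 4 _∋_ _⊑_ _≺_

record _∋_ (I : Interval) (x : ℚ) : Set where
  constructor ∋⟨_,_⟩
  field
    lo≤ : lo I ≤ x
    ≤hi : x ≤ hi I

record _⊑_ (I J : Interval) : Set where
  constructor ⊑⟨_,_⟩
  field
    lo-⊑ : lo J ≤ lo I
    hi-⊑ : hi I ≤ hi J

_≺_ : Interval → Interval → Set
I ≺ J = hi I < lo J

reflect : Interval → Interval
reflect I = [ - hi I , - lo I ]⟨ neg-antimono-≤ (lo≤hi I) ⟩

∩-ends : Interval → Interval → Fin 2 → ℚ
∩-ends I J 0F = lo I ⊔ lo J
∩-ends I J 1F = hi I ⊓ hi J

∋⇒meets : ∀ {I J x} → I ∋ x → J ∋ x → Meets I J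
∋⇒meets ∋⟨ lI≤x , x≤hI ⟩ ∋⟨ lJ≤x , x≤hJ ⟩ = ≤-trans lI≤x x≤hJ , ≤-trans lJ≤x x≤hI

meets-⊑ : ∀ {I J K} → Meets I J → J ⊑ K → Meets I K
meets-⊑ (lI≤hJ , lJ≤hI) ⊑⟨ lK≤lJ , hJ≤hK ⟩ = ≤-trans lI≤hJ hJ≤hK , ≤-trans lK≤lJ lJ≤hI

¬meets⇒≺⊎≻ : ∀ {I J} → ¬ Meets I J → I ≺ J ⊎ J ≺ I
¬meets⇒≺⊎≻ {I} {J} ¬IJ with lo I ≤? hi J | lo J ≤? hi I
... | yes lI≤hJ | yes lJ≤hI = ⊥-elim (¬IJ (lI≤hJ , lJ≤hI))
... | no lI≰hJ  | _         = inj₂ (≰⇒> lI≰hJ)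
... | yes _     | no lJ≰hI  = inj₁ (≰⇒> lJ≰hI)

≺-reflect : ∀ {I J} → I ≺ J → reflect J ≺ reflect I
≺-reflect = neg-antimono-<

meets-reflect : ∀ {I J} → Meets I J ⇔ Meets (reflect I) (reflect J)
meets-reflect = mk⇔ (λ (lI≤hJ , lJ≤hI) → neg-antimono-≤ lJ≤hI , neg-antimono-≤ lI≤hJ)
                    (λ (l₁ , l₂) → neg-cancel-≤ l₂ , neg-cancel-≤ l₁)
  where
  neg-cancel-≤ : ∀ {x y} → - x ≤ - y → y ≤ x
  neg-cancel-≤ {x} {y} =
    subst₂ _≤_ (⁻¹-involutive +-0-group y) (⁻¹-involutive +-0-group x) ∘ neg-antimono-≤

nested⊎∋∩-end : ∀ {I J K} → Meets K I → Meets K J →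
                (K ⊑ I × K ⊑ J) ⊎ ∃ λ t → K ∋ ∩-ends I J t
nested⊎∋∩-end {I} {J} {K} (lK≤hI , lI≤hK) (lK≤hJ , lJ≤hK)
  with lo K ≤? lo I ⊔ lo J | hi I ⊓ hi J ≤? hi K
... | yes lK≤⊔ | _         = inj₂ (0F , ∋⟨ lK≤⊔ , ⊔-lub lI≤hK lJ≤hK ⟩)
... | no _     | yes ⊓≤hK = inj₂ (1F , ∋⟨ ⊓-glb lK≤hI lK≤hJ , ⊓≤hK ⟩)
... | no lK≰⊔  | no ⊓≰hK  =
  inj₁ (⊑⟨ ≤-trans (p≤p⊔q (lo I) (lo J)) ⊔≤lK , ≤-trans hK≤⊓ (p⊓q≤p (hi I) (hi J)) ⟩ ,
        ⊑⟨ ≤-trans (p≤q⊔p (lo I) (lo J)) ⊔≤lK , ≤-trans hK≤⊓ (p⊓q≤q (hi I) (hi J)) ⟩)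
  where
  ⊔≤lK = <⇒≤ (≰⇒> lK≰⊔)
  hK≤⊓ = <⇒≤ (≰⇒> ⊓≰hK)

boxRep-suc : ∀ {V Adj n} → BoxRep V Adj n → BoxRep V Adj (ℕ.suc n)
boxRep-suc {V} {Adj} {n} (f , represents) = f′ , λ u v u≢v →
  let open Equivalence (represents u v u≢v) in
  mk⇔ (λ uv → λ { zero → ≤-refl , ≤-refl ; (suc k) → to uv k }) (λ meet → from (meet ∘ suc))
  where
  f′ : V → Box (ℕ.suc n)
  f′ v zero    = [ 0ℚ , 0ℚ ]⟨ ≤-refl ⟩
  f′ v (suc k) = f v k

boxRep-mono : ∀ {V Adj n n′} → n ℕ.≤ n′ → BoxRep V Adj n → BoxRep V Adj n′
boxRep-mono {V} {Adj} = go ∘ ℕ.≤⇒≤′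
  where
  go : ∀ {n n′} → n ℕ.≤′ n′ → BoxRep V Adj n → BoxRep V Adj n′
  go ℕ.≤′-refl        = id
  go (ℕ.≤′-step n≤n′) = boxRep-suc ∘ go n≤n′

fromℕ : ℕ → ℚ
fromℕ n = fromℤ (+ n)

fromℕ-mono-≤ : ∀ {m n} → m ℕ.≤ n → fromℕ m ≤ fromℕ n
fromℕ-mono-≤ {m} {n} m≤n =
  *≤* (subst₂ ℤ._≤_ (sym (ℤ.*-identityʳ (+ m))) (sym (ℤ.*-identityʳ (+ n))) (ℤ.+≤+ m≤n))

fromℕ-cancel-≤ : ∀ {m n} → fromℕ m ≤ fromℕ n → m ℕ.≤ n
fromℕ-cancel-≤ {m} {n} m≤n =
  ℤ.drop‿+≤+ (subst₂ ℤ._≤_ (ℤ.*-identityʳ (+ m)) (ℤ.*-identityʳ (+ n)) (drop-*≤* m≤n))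

Meetsℕ : ℕ × ℕ → ℕ × ℕ → Set
Meetsℕ (l , h) (l′ , h′) = l ℕ.≤ h′ × l′ ℕ.≤ h

meetsℕ? : ∀ x y → Dec (Meetsℕ x y)
meetsℕ? (l , h) (l′ , h′) = l ℕ.≤? h′ ×-dec l′ ℕ.≤? h

boxRep-fromℕ : ∀ {V Adj n} (B : V → Fin n → ℕ × ℕ) →
               (∀ v k → proj₁ (B v k) ℕ.≤ proj₂ (B v k)) →
               (∀ u v → u ≢ v → Adj u v ⇔ (∀ k → Meetsℕ (B u k) (B v k))) →
               BoxRep V Adj n
boxRep-fromℕ {V} {n = n} B nonempty represents = box , λ u v u≢v →
  let open Equivalence (represents u v u≢v) in
  mk⇔ (λ uv k → let l≤h′ , l′≤h = to uv k in fromℕ-mono-≤ l≤h′ , fromℕ-mono-≤ l′≤h)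
      (λ meet → from λ k →
         let l≤h′ , l′≤h = meet k in fromℕ-cancel-≤ l≤h′ , fromℕ-cancel-≤ l′≤h)
  where
  box : V → Box n
  box v k = [ fromℕ (proj₁ (B v k)) , fromℕ (proj₂ (B v k)) ]⟨ fromℕ-mono-≤ (nonempty v k) ⟩

_⇔-dec_ : ∀ {A B : Set} → Dec A → Dec B → Dec (A ⇔ B)
A? ⇔-dec B? = map′ (uncurry mk⇔) (λ A⇔B → to A⇔B , from A⇔B) ((A? →-dec B?) ×-dec (B? →-dec A?))
  where open Equivalence

-- A box representation in dimension 2 with its coordinates I and J kept apart, so that
-- swapping them or reflecting J yields another one.
record RectRep {V : Set} (Adj : V → V → Set) (I J : V → Interval) : Set where
  constructor rectRep
  field
    adj⇔meets : ∀ u v → u ≢ v → Adj u v ⇔ (Meets (I u) (I v) × Meets (J u) (J v))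

open RectRep

boxRep⇒rectRep : ∀ {V Adj} → ((f , _) : BoxRep V Adj 2) →
                 RectRep Adj (λ v → f v 0F) (λ v → f v 1F)
boxRep⇒rectRep (f , represents) = rectRep λ u v u≢v →
  let open Equivalence (represents u v u≢v) in
  mk⇔ (λ uv → to uv 0F , to uv 1F) (λ (m₀ , m₁) → from λ { 0F → m₀ ; 1F → m₁ })

module _ {V : Set} {Adj : V → V → Set} {I J : V → Interval} (rep : RectRep Adj I J) where

  rectRep-swap : RectRep Adj J I
  rectRep-swap = rectRep λ u v u≢v →
    let open Equivalence (adj⇔meets rep u v u≢v) in
    mk⇔ (swap ∘ to) (from ∘ swap)

  rectRep-reflect : RectRep Adj I (reflect ∘ J)
  rectRep-reflect = rectRep λ u v u≢v →
    let open Equivalence (adj⇔meets rep u v u≢v)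
        module J-reflect = Equivalence (meets-reflect {J u} {J v})
    in mk⇔ (λ uv → let Iuv , Juv = to uv in Iuv , J-reflect.to Juv)
           (λ (Iuv , Juv) → from (Iuv , J-reflect.from Juv))

Independent : {V : Set} → (V → V → Set) → {n : ℕ} → (Fin n → V) → Set
Independent Adj F = Injective _≡_ _≡_ F × (∀ k k′ → ¬ Adj (F k) (F k′))

module Rectangles {V : Set} {Adj : V → V → Set} (irrefl : Irreflexive _≡_ Adj)
                  {I J : V → Interval} (rep : RectRep Adj I J) where

  meets : ∀ {u v} → Adj u v → Meets (I u) (I v) × Meets (J u) (J v)
  meets uv = Equivalence.to (adj⇔meets rep _ _ λ u≡v → irrefl u≡v uv) uv

  meetsᴵ : ∀ {u v} → Adj u v → Meets (I u) (I v)
  meetsᴵ = proj₁ ∘ meets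

  meetsᴶ : ∀ {u v} → Adj u v → Meets (J u) (J v)
  meetsᴶ = proj₂ ∘ meets

  nonadjacent : ∀ u v → u ≢ v → ¬ Adj u v → ¬ (Meets (I u) (I v) × Meets (J u) (J v))
  nonadjacent _ _ u≢v ¬uv = ¬uv ∘ Equivalence.from (adj⇔meets rep _ _ u≢v)

  separatedᴶ : ∀ u v → u ≢ v → ¬ Adj u v → Meets (I u) (I v) → J u ≺ J v ⊎ J v ≺ J u
  separatedᴶ u v u≢v ¬uv Iuv =
    ¬meets⇒≺⊎≻ {J u} {J v} λ Juv → nonadjacent u v u≢v ¬uv (Iuv , Juv)

  pierce : ∀ {m₁ m₂ n} {F : Fin n → V} → Independent Adj F → m₁ * m₂ ℕ.< n →
           (x : Fin m₁ → ℚ) (y : Fin m₂ → ℚ) (σ : Fin n → Fin m₁) (τ : Fin n → Fin m₂) →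
           ¬ (∀ k → I (F k) ∋ x (σ k) × J (F k) ∋ y (τ k))
  pierce {F = F} (injective , independent) grid<n x y σ τ pierced
    with k , k′ , k<k′ , same ← pigeonhole grid<n (λ k → combine (σ k) (τ k))
    with σₖ≡σₖ′ , τₖ≡τₖ′ ← combine-injective _ _ _ _ same
    = nonadjacent (F k) (F k′) (<⇒≢ k<k′ ∘ injective) (independent k k′)
        ( ∋⇒meets (proj₁ (pierced k))
                  (subst (I (F k′) ∋_) (cong x (sym σₖ≡σₖ′)) (proj₁ (pierced k′)))
        , ∋⇒meets (proj₂ (pierced k))
                  (subst (J (F k′) ∋_) (cong y (sym τₖ≡τₖ′)) (proj₂ (pierced k′))))

  common-neighbours-nested : ∀ {n u w} {F : Fin n → V} → Independent Adj F → 4 ℕ.< n →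
    (∀ k → Adj (F k) u × Adj (F k) w) →
    (∀ k → ¬ (I (F k) ⊑ I u × I (F k) ⊑ I w)) →
    (∀ k → ¬ (J (F k) ⊑ J u × J (F k) ⊑ J w)) → ⊥
  common-neighbours-nested {u = u} {w} {F} independent 4<n adjacent ¬nestedᴵ ¬nestedᴶ =
    pierce independent 4<n (∩-ends (I u) (I w)) (∩-ends (J u) (J w))
      (proj₁ ∘ endᴵ) (proj₁ ∘ endᴶ) (λ k → proj₂ (endᴵ k) , proj₂ (endᴶ k))
    where
    end : {K : V → Interval} → (∀ {x y} → Adj x y → Meets (K x) (K y)) →
          (∀ k → ¬ (K (F k) ⊑ K u × K (F k) ⊑ K w)) →
          ∀ k → ∃ λ t → K (F k) ∋ ∩-ends (K u) (K w) t
    end {K} meetsᴷ ¬nested k = [ ⊥-elim ∘ ¬nested k , id ]′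
      (nested⊎∋∩-end {K u} {K w} {K (F k)} (meetsᴷ (proj₁ (adjacent k)))
                                           (meetsᴷ (proj₂ (adjacent k))))
    endᴵ = end meetsᴵ ¬nestedᴵ
    endᴶ = end meetsᴶ ¬nestedᴶ

Code : Set
Code = Fin 9 × Fin 5 × Fin 5

code : Vtx → Code
code a       = 0F , 0F , 0F
code b       = 1F , 0F , 0F
code (c i)   = 2F , i , 0F
code (d i j) = 3F , i , j
code (e i j) = 4F , i , j
code (p i j) = 5F , i , j
code (q i j) = 6F , i , j
code (r i j) = 7F , i , j
code (s i j) = 8F , i , j

decode : Code → Vtx
decode (0F , _ , _) = a
decode (1F , _ , _) = b
decode (2F , i , _) = c i
decode (3F , i , j) = d i j
decode (4F , i , j) = e i j
decode (5F , i , j) = p i j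
decode (6F , i , j) = q i j
decode (7F , i , j) = r i j
decode (8F , i , j) = s i j

decode-code : ∀ v → decode (code v) ≡ v
decode-code a       = refl
decode-code b       = refl
decode-code (c i)   = refl
decode-code (d i j) = refl
decode-code (e i j) = refl
decode-code (p i j) = refl
decode-code (q i j) = refl
decode-code (r i j) = refl
decode-code (s i j) = refl

code-injective : ∀ {u v} → code u ≡ code v → u ≡ v
code-injective {u} {v} eq = trans (sym (decode-code u)) (trans (cong decode eq) (decode-code v))

_≟_ : DecidableEquality Vtx
u ≟ v = map′ code-injective (cong code) (×.≡-dec _≟ᶠ_ (×.≡-dec _≟ᶠ_ _≟ᶠ_) (code u) (code v))

all-Vtx? : {P : Vtx → Set} → Decidable P → Dec (∀ v → P v)
all-Vtx? {P} P? =
  map′ every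
       (λ ∀P → ∀P a , ∀P b , ∀P ∘ c , ∀P ∘₂ d , ∀P ∘₂ e , ∀P ∘₂ p , ∀P ∘₂ q , ∀P ∘₂ r , ∀P ∘₂ s)
       (P? a ×-dec P? b ×-dec all? (P? ∘ c) ×-dec
        all²? d ×-dec all²? e ×-dec all²? p ×-dec all²? q ×-dec all²? r ×-dec all²? s)
  where
  All² : (Fin 5 → Fin 5 → Vtx) → Set
  All² f = ∀ i j → P (f i j)
  all²? : ∀ f → Dec (All² f)
  all²? f = all? λ i → all? λ j → P? (f i j)
  every : P a × P b × (∀ i → P (c i)) × All² d × All² e × All² p × All² q × All² r × All² s →
          ∀ v → P v
  every (pa , pb , pc , pd , pe , pp , pq , pr , ps) = λ where
    a       → pa
    b       → pb
    (c i)   → pc i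
    (d i j) → pd i j
    (e i j) → pe i j
    (p i j) → pp i j
    (q i j) → pq i j
    (r i j) → pr i j
    (s i j) → ps i j

-- Each vertex other than a arises by splitting the edge between its parents, and every edge
-- joins a vertex to one of its parents.
parents : Vtx → List Vtx
parents a       = []
parents b       = a ∷ []
parents (c i)   = a ∷ b ∷ []
parents (d i j) = a ∷ c i ∷ []
parents (e i j) = b ∷ c i ∷ []
parents (p i j) = a ∷ d i j ∷ []
parents (q i j) = c i ∷ d i j ∷ []
parents (r i j) = b ∷ e i j ∷ []
parents (s i j) = c i ∷ e i j ∷ []

edge⇒parent : ∀ {u v} → Edge u v → u ∈ parents v
edge⇒parent ab       = here refl
edge⇒parent (ac i)   = here refl
edge⇒parent (bc i)   = there (here refl)
edge⇒parent (ad i j) = here refl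
edge⇒parent (cd i j) = there (here refl)
edge⇒parent (be i j) = here refl
edge⇒parent (ce i j) = there (here refl)
edge⇒parent (ap i j) = here refl
edge⇒parent (dp i j) = there (here refl)
edge⇒parent (cq i j) = here refl
edge⇒parent (dq i j) = there (here refl)
edge⇒parent (br i j) = here refl
edge⇒parent (er i j) = there (here refl)
edge⇒parent (cs i j) = here refl
edge⇒parent (es i j) = there (here refl)

parent⇒edge : ∀ {u} v → u ∈ parents v → Edge u v
parent⇒edge b       (here refl)         = ab
parent⇒edge (c i)   (here refl)         = ac i
parent⇒edge (c i)   (there (here refl)) = bc i
parent⇒edge (d i j) (here refl)         = ad i j
parent⇒edge (d i j) (there (here refl)) = cd i j
parent⇒edge (e i j) (here refl)         = be i j
parent⇒edge (e i j) (there (here refl)) = ce i j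
parent⇒edge (p i j) (here refl)         = ap i j
parent⇒edge (p i j) (there (here refl)) = dp i j
parent⇒edge (q i j) (here refl)         = cq i j
parent⇒edge (q i j) (there (here refl)) = dq i j
parent⇒edge (r i j) (here refl)         = br i j
parent⇒edge (r i j) (there (here refl)) = er i j
parent⇒edge (s i j) (here refl)         = cs i j
parent⇒edge (s i j) (there (here refl)) = es i j

open DecMembership _≟_ using (_∈?_)

edge? : ∀ u v → Dec (Edge u v)
edge? u v = map′ (parent⇒edge v) edge⇒parent (u ∈? parents v)

adj? : ∀ u v → Dec (Adj u v)
adj? u v = edge? u v ⊎-dec edge? v u

adj-irrefl : Irreflexive _≡_ Adj
adj-irrefl refl (inj₁ ())
adj-irrefl refl (inj₂ ())

c-independent : Independent Adj c
c-independent = (λ { refl → refl }) , λ _ _ → λ { (inj₁ ()) ; (inj₂ ()) }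

d-independent : ∀ i → Independent Adj (d i)
d-independent i = (λ { refl → refl }) , λ _ _ → λ { (inj₁ ()) ; (inj₂ ()) }

block : Fin 5 → ℕ × ℕ
block i = 20 * toℕ i , 20 * toℕ i + 19

slot : Fin 5 → Fin 5 → ℕ → ℕ → ℕ × ℕ
slot i j l h = 20 * toℕ i + 4 * toℕ j + l , 20 * toℕ i + 4 * toℕ j + h

-- Coordinate 0 gives each c_i a block, inside which the d_{ij}, e_{ij} and their children
-- occupy disjoint slots; coordinate 1 separates the side of a (d, p, q) from that of b (e, r, s);
-- coordinate 2 separates the children p, r of a, b from the children q, s of c_i.
layout : Vtx → Vec (ℕ × ℕ) 3
layout a       = (0 , 99)     ∷ (0 , 10)  ∷ (0 , 10)  ∷ []
layout b       = (0 , 99)     ∷ (10 , 20) ∷ (0 , 10)  ∷ []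
layout (c i)   = block i      ∷ (5 , 15)  ∷ (5 , 15)  ∷ []
layout (d i j) = slot i j 0 1 ∷ (6 , 9)   ∷ (1 , 13)  ∷ []
layout (e i j) = slot i j 2 3 ∷ (11 , 14) ∷ (1 , 13)  ∷ []
layout (p i j) = slot i j 0 0 ∷ (7 , 8)   ∷ (1 , 2)   ∷ []
layout (q i j) = slot i j 1 1 ∷ (7 , 8)   ∷ (12 , 13) ∷ []
layout (r i j) = slot i j 2 2 ∷ (12 , 13) ∷ (1 , 2)   ∷ []
layout (s i j) = slot i j 3 3 ∷ (12 , 13) ∷ (12 , 13) ∷ []

coord : Vtx → Fin 3 → ℕ × ℕ
coord = lookup ∘ layout

layout-nonempty : ∀ v k → proj₁ (coord v k) ℕ.≤ proj₂ (coord v k)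
layout-nonempty = from-yes (all-Vtx? λ v → all? λ k → proj₁ (coord v k) ℕ.≤? proj₂ (coord v k))

layout-represents : ∀ u v → u ≢ v → Adj u v ⇔ (∀ k → Meetsℕ (coord u k) (coord v k))
layout-represents = from-yes (all-Vtx? λ u → all-Vtx? λ v →
  ¬? (u ≟ v) →-dec (adj? u v ⇔-dec all? λ k → meetsℕ? (coord u k) (coord v k)))

layout-boxRep : BoxRep Vtx Adj 3
layout-boxRep = boxRep-fromℕ coord layout-nonempty layout-represents

module _ {I J : Vtx → Interval} (rep : RectRep Adj I J) (i : Fin 5) where
  open Rectangles adj-irrefl rep
  open ≤-Reasoning

  d-below-b : I (c i) ⊑ I b → J a ≺ J (e i 0F) → ∀ j → J (d i j) ≺ J b
  d-below-b c⊑b a≺e j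
    with separatedᴶ (d i j) b (λ ()) (λ { (inj₁ ()) ; (inj₂ ()) })
                    (meets-⊑ {I (d i j)} (meetsᴵ (inj₂ (cd i j))) c⊑b)
  ... | inj₁ d≺b = d≺b
  ... | inj₂ b≺d = ⊥-elim (<-irrefl refl (begin-strict
    hi (J b)        <⟨ b≺d ⟩
    lo (J (d i j))  ≤⟨ proj₁ (meetsᴶ (inj₂ (ad i j))) ⟩
    hi (J a)        <⟨ a≺e ⟩
    lo (J (e i 0F)) ≤⟨ proj₁ (meetsᴶ (inj₂ (be i 0F))) ⟩
    hi (J b)        ∎))

  d-not-nestedᴵ : I (c i) ⊑ I a → I (c i) ⊑ I b → J a ≺ J (e i 0F) →
                  ∀ j → ¬ (I (d i j) ⊑ I a × I (d i j) ⊑ I (c i))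
  d-not-nestedᴵ c⊑a c⊑b a≺e j (d⊑a , d⊑c) =
    [ p-not-below-c , p-not-above-c ]′
      (separatedᴶ (p i j) (c i) (λ ()) (λ { (inj₁ ()) ; (inj₂ ()) })
                  (meets-⊑ {I (p i j)} (meetsᴵ (inj₂ (dp i j))) d⊑c))
    where
    d≺b = d-below-b c⊑b a≺e j
    q≺a : J (q i j) ≺ J a
    q≺a with separatedᴶ (q i j) a (λ ()) (λ { (inj₁ ()) ; (inj₂ ()) })
                        (meets-⊑ {I (q i j)} (meetsᴵ (inj₂ (dq i j))) d⊑a)
    ... | inj₁ q≺a = q≺a
    ... | inj₂ a≺q = ⊥-elim (<-irrefl refl (begin-strict
      hi (J a)        <⟨ a≺q ⟩
      lo (J (q i j))  ≤⟨ proj₁ (meetsᴶ (inj₂ (dq i j))) ⟩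
      hi (J (d i j))  <⟨ d≺b ⟩
      lo (J b)        ≤⟨ proj₁ (meetsᴶ (inj₂ ab)) ⟩
      hi (J a)        ∎))
    p-not-below-c : ¬ J (p i j) ≺ J (c i)
    p-not-below-c p≺c = <-irrefl refl (begin-strict
      hi (J (p i j))  <⟨ p≺c ⟩
      lo (J (c i))    ≤⟨ proj₁ (meetsᴶ (inj₁ (cq i j))) ⟩
      hi (J (q i j))  <⟨ q≺a ⟩
      lo (J a)        ≤⟨ proj₁ (meetsᴶ (inj₁ (ap i j))) ⟩
      hi (J (p i j))  ∎)
    p-not-above-c : ¬ J (c i) ≺ J (p i j)
    p-not-above-c c≺p = <-irrefl refl (begin-strict
      hi (J (c i))    <⟨ c≺p ⟩
      lo (J (p i j))  ≤⟨ proj₁ (meetsᴶ (inj₂ (dp i j))) ⟩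
      hi (J (d i j))  <⟨ d≺b ⟩
      lo (J b)        ≤⟨ proj₁ (meetsᴶ (inj₂ ab)) ⟩
      hi (J a)        <⟨ a≺e ⟩
      lo (J (e i 0F)) ≤⟨ proj₁ (meetsᴶ (inj₂ (ce i 0F))) ⟩
      hi (J (c i))    ∎)

  d-not-nestedᴶ : I (c i) ⊑ I a → ∀ j → ¬ J (d i j) ⊑ J a
  d-not-nestedᴶ c⊑a j d⊑a = nonadjacent (q i j) a (λ ()) (λ { (inj₁ ()) ; (inj₂ ()) })
    ( meets-⊑ {I (q i j)} (meetsᴵ (inj₂ (cq i j))) c⊑a
    , meets-⊑ {J (q i j)} (meetsᴶ (inj₂ (dq i j))) d⊑a )

  c-nested⇒¬a≺e : I (c i) ⊑ I a → I (c i) ⊑ I b → ¬ J a ≺ J (e i 0F)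
  c-nested⇒¬a≺e c⊑a c⊑b a≺e =
    common-neighbours-nested (d-independent i) ℕ.≤-refl (λ j → inj₂ (ad i j) , inj₂ (cd i j))
      (d-not-nestedᴵ c⊑a c⊑b a≺e) (λ j → d-not-nestedᴶ c⊑a j ∘ proj₁)

c-not-nested : ∀ {I J} → RectRep Adj I J → ∀ i → ¬ (I (c i) ⊑ I a × I (c i) ⊑ I b)
c-not-nested {I} {J} rep i (c⊑a , c⊑b) =
  [ c-nested⇒¬a≺e (rectRep-reflect rep) i c⊑a c⊑b ∘ ≺-reflect {J (e i 0F)} {J a}
  , c-nested⇒¬a≺e rep i c⊑a c⊑b
  ]′ (separatedᴶ (e i 0F) a (λ ()) (λ { (inj₁ ()) ; (inj₂ ()) })
                 (meets-⊑ {I (e i 0F)} (meetsᴵ (inj₂ (ce i 0F))) c⊑a))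
  where open Rectangles adj-irrefl rep

no-rectRep : ∀ {I J} → ¬ RectRep Adj I J
no-rectRep rep = common-neighbours-nested c-independent ℕ.≤-refl (λ i → inj₂ (ac i) , inj₂ (bc i))
  (c-not-nested rep) (c-not-nested (rectRep-swap rep))
  where open Rectangles adj-irrefl rep

theorem4 : HasBoxicity Vtx Adj 3
theorem4 = layout-boxRep , λ n n<3 → no-rectRep ∘ boxRep⇒rectRep ∘ boxRep-mono (ℕ.≤-pred n<3)
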